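{- Let $\mathcal{P}$ be the conjunction of population protocols $\mathcal{P}_1$ and $\mathcal{P}_2$ (defined in the context). If $\mathcal{P}_1$ and $\mathcal{P}_2$ satisfy strong consensus, then $\mathcal{P}$ satisfies strong consensus.
   Context: A population over finite $E$ is $M:E\to\mathbb{N}$ with $\sum_e M(e)\ge 2$. A population protocol is $(Q,T,\Sigma,I,O)$ with $T\subseteq Q^2\times Q^2$ containing for each $(p,q)$ some $(p,q,p',q')$, $I:\Sigma\to Q$, $O:Q\to\{0,1\}$. Configurations are populations over $Q$. For $t=(p,q,p',q')$, written $(p,q)\mapsto(p',q')$, $\mathrm{pre}(t)$, $\mathrm{post}(t)$ are the multisets $\{p,q\}$, $\{p',q'\}$; $t$ is enabled at $C$ if $C\ge\mathrm{pre}(t)$, leading to $C-\mathrm{pre}(t)+\mathrm{post}(t)$. $C$ is terminal if every configuration reachable from $C$ equals $C$; $C$ is a consensus configuration if all states in $\mathrm{supp}(C)$ have the same output $O(C)$. For an input $X$ (population over $\Sigma$), $I(X)(q)=\sum_{\sigma:I(\sigma)=q}X(\sigma)$; such configurations are initial. Flow equations for $C,C',x:T\to\mathbb{N}$: $C'(q)=C(q)+\sum_t x(t)(\mathrm{post}(t)(q)-\mathrm{pre}(t)(q))$ for all $q$. For $R\subseteq Q$: ${}^\bullet R=\{t:\mathrm{supp}(\mathrm{post}(t))\cap R\ne\emptyset\}$, $R^\bullet=\{t:\mathrm{supp}(\mathrm{pre}(t))\cap R\ne\emptyset\}$, $C(R)=\sum_{q\in R}C(q)$. For $U\subseteq T$,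 $P$ is a $U$-trap if $P^\bullet\cap U\subseteq{}^\bullet P$, a $U$-siphon if ${}^\bullet P\cap U\subseteq P^\bullet$. $C'$ is potentially reachable from $C$ if for some $x:T\to\mathbb{N}$, with $U=\mathrm{supp}(x)$, the flow equations hold, $C'(P)=0\Rightarrow{}^\bullet P\cap U=\emptyset$ for every $U$-trap $P$, and $C(P)=0\Rightarrow P^\bullet\cap U=\emptyset$ for every $U$-siphon $P$. Strong consensus: for every initial $C$ there is $b\in\{0,1\}$ such that every terminal $C'$ potentially reachable from $C$ is a consensus configuration with $O(C')=b$. Conjunction: for $\mathcal{P}_1=(Q_1,T_1,\Sigma,I_1,O_1)$, $\mathcal{P}_2=(Q_2,T_2,\Sigma,I_2,O_2)$, $\mathcal{P}=(Q_1\times Q_2,S_1\cup S_2,\Sigma,I,O)$ with $I(\sigma)=(I_1(\sigma),I_2(\sigma))$, $O(p,q)=O_1(p)\wedge O_2(q)$, $S_1=\{((p,r),(p',r'))\mapsto((q,r),(q',r')):(p,p',q,q')\in T_1,\ r,r'\in Q_2\}$, $S_2=\{((r,p),(r',p'))\mapsto((r,q),(r',q')):(p,p',q,q')\in T_2,\ r,r'\in Q_1\}$. -}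

module Defs where

open import Data.Bool using (Bool; true; false; _∧_; if_then_else_)
open import Data.Nat using (ℕ; zero; suc; _+_; _*_; _∸_; _≤_; _<_)
open import Data.List using (List; map; cartesianProduct)
open import Data.Nat.ListAction using (sum)
open import Data.List.Membership.Propositional using (_∈_)
open import Data.List.Membership.Propositional.Properties using (∈-cartesianProduct⁺)
open import Data.List.Relation.Unary.Unique.Propositional using (Unique)
import Data.List.Relation.Unary.Unique.Propositional.Properties as UniqueP
open import Data.Product using (Σ; ∃; ∃₂; _×_; _,_; proj₁; proj₂)
open import Data.Product.Properties using (≡-dec)
open import Data.Sum using (_⊎_; inj₁; inj₂)
open import Relation.Nullary using (¬_; yes; no)
open import Relation.Binary.PropositionalEquality using (_≡_; _≢_; refl)
open import Relation.Binary.Definitions using (DecidableEquality)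
open import Relation.Binary.Construct.Closure.ReflexiveTransitive using (Star)

record FinSet : Set₁ where
  field
    Carrier  : Set
    _≟_      : DecidableEquality Carrier
    enum     : List Carrier
    complete : ∀ x → x ∈ enum
    unique   : Unique enum

open FinSet public

_×ᶠ_ : FinSet → FinSet → FinSet
A ×ᶠ B = record
  { Carrier  = Carrier A × Carrier B
  ; _≟_      = ≡-dec (_≟_ A) (_≟_ B)
  ; enum     = cartesianProduct (enum A) (enum B)
  ; complete = λ { (a , b) → ∈-cartesianProduct⁺ (complete A a) (complete B b) }
  ; unique   = UniqueP.cartesianProduct⁺ (unique A) (unique B)
  }

∑ : (A : FinSet) → (Carrier A → ℕ) → ℕ
∑ A f = sum (map f (enum A))

IsPopulation : (E : FinSet) → (Carrier E → ℕ) → Set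
IsPopulation E M = 2 ≤ ∑ E M

δ : (A : FinSet) → Carrier A → Carrier A → ℕ
δ A a b with _≟_ A a b
... | yes _ = 1
... | no  _ = 0

-- Population protocols.  A transition (p,q) ↦ (p',q') is the tuple
-- (p , q , p' , q'); T is a subset of Q⁴.

Trans : FinSet → FinSet
Trans Q = Q ×ᶠ (Q ×ᶠ (Q ×ᶠ Q))

record Protocol (Alph : FinSet) : Set₁ where
  field
    Q     : FinSet
    T     : Carrier (Trans Q) → Set
    total : ∀ p q → ∃₂ λ p' q' → T (p , q , p' , q')
    I     : Carrier Alph → Carrier Q
    O     : Carrier Q → Bool

module _ {Alph : FinSet} (𝒫 : Protocol Alph) where
  open Protocol 𝒫

  Tr : Set
  Tr = Carrier (Trans Q)

  Config : Set
  Config = Carrier Q → ℕ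

  pre : Tr → Config
  pre (p , q , p' , q') r = δ Q p r + δ Q q r

  post : Tr → Config
  post (p , q , p' , q') r = δ Q p' r + δ Q q' r

  Step : Config → Config → Set
  Step C C' = ∃ λ t → T t × (∀ r → pre t r ≤ C r)
                    × (∀ r → C' r ≡ (C r ∸ pre t r) + post t r)

  Reachable : Config → Config → Set
  Reachable = Star Step

  Terminal : Config → Set
  Terminal C = ∀ C' → Reachable C C' → ∀ q → C' q ≡ C q

  ConsensusWith : Config → Bool → Set
  ConsensusWith C b = ∀ q → 0 < C q → O q ≡ b

  initial : (Carrier Alph → ℕ) → Config
  initial X q = ∑ Alph (λ σ → δ Q (I σ) q * X σ)

  -- sets of states P ⊆ Q are given by characteristic functions
  -- C(P)
  count : Config → (Carrier Q → Bool) → ℕ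
  count C P = ∑ Q (λ q → if P q then C q else 0)

  _∈Out_ : Tr → (Carrier Q → Bool) → Set
  (p , q , p' , q') ∈Out P = P p ≡ true ⊎ P q ≡ true

  _∈In_ : Tr → (Carrier Q → Bool) → Set
  (p , q , p' , q') ∈In P = P p' ≡ true ⊎ P q' ≡ true

  IsTrap : (Tr → Set) → (Carrier Q → Bool) → Set
  IsTrap U P = ∀ t → t ∈Out P → U t → t ∈In P

  IsSiphon : (Tr → Set) → (Carrier Q → Bool) → Set
  IsSiphon U P = ∀ t → t ∈In P → U t → t ∈Out P

  PotReach : Config → Config → Set
  PotReach C C' =
    Σ (Tr → ℕ) λ x →
      let U : Tr → Set
          U t = x t ≢ 0 in
      -- x is a function on T (zero outside T)
      (∀ t → ¬ T t → x t ≡ 0)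
      -- flow equations (negative terms moved to the left)
      × (∀ q → C' q + ∑ (Trans Q) (λ t → x t * pre t q)
               ≡ C q + ∑ (Trans Q) (λ t → x t * post t q))
      × (∀ P → IsTrap U P → count C' P ≡ 0 → ∀ t → t ∈In P → ¬ U t)
      × (∀ P → IsSiphon U P → count C P ≡ 0 → ∀ t → t ∈Out P → ¬ U t)

  StrongConsensus : Set
  StrongConsensus =
    ∀ X → IsPopulation Alph X →
      ∃ λ b → ∀ C' → IsPopulation Q C' → Terminal C' →
                PotReach (initial X) C' → ConsensusWith C' b

module _ {Alph : FinSet} (𝒫₁ 𝒫₂ : Protocol Alph) where
  private
    module P₁ = Protocol 𝒫₁
    module P₂ = Protocol 𝒫₂

  S₁ : Carrier (Trans (P₁.Q ×ᶠ P₂.Q)) → Set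
  S₁ t = ∃ λ ((p , p' , q , q') : Carrier (Trans P₁.Q)) → P₁.T (p , p' , q , q') ×
           ∃₂ λ r r' → t ≡ ((p , r) , (p' , r') , (q , r) , (q' , r'))

  S₂ : Carrier (Trans (P₁.Q ×ᶠ P₂.Q)) → Set
  S₂ t = ∃ λ ((p , p' , q , q') : Carrier (Trans P₂.Q)) → P₂.T (p , p' , q , q') ×
           ∃₂ λ r r' → t ≡ ((r , p) , (r' , p') , (r , q) , (r' , q'))

  conjunction : Protocol Alph
  conjunction = record
    { Q     = P₁.Q ×ᶠ P₂.Q
    ; T     = λ t → S₁ t ⊎ S₂ t
    ; total = λ { (p , r) (p' , r') →
                   let (q , q' , h) = P₁.total p p' in
                   (q , r) , (q' , r') , inj₁ ((p , p' , q , q') , h , r , r' , refl) }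
    ; I     = λ σ → P₁.I σ , P₂.I σ
    ; O     = λ { (p , q) → P₁.O p ∧ P₂.O q }
    }

module Submission where

-- Project each configuration of the conjunction onto a component by summing out the
-- other coordinate. Every component transition lifts to the conjunction from any
-- preimages of its inputs, so projections of terminal configurations are terminal.
-- Potential reachability is also preserved: the pushed-forward transition counts, with
-- the transitions that are silent in the component dropped, satisfy the flow equations,
-- and traps and siphons of the component pull back to the conjunction. Strong consensus
-- of the two components then fixes both output bits on every occupied state.

open import Defs
open import Data.Bool using (Bool; true; false; _∧_; if_then_else_)
open import Data.Nat using (ℕ; zero; suc; _+_; _*_; _∸_; _≤_; _<_; z≤n; s≤s; s≤s⁻¹)
  renaming (_≟_ to _≟ℕ_)
open import Data.Nat.Properties hiding (_≟_)
open import Algebra.Properties.CommutativeSemigroup +-commutativeSemigroup using (interchange)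
open import Algebra.Properties.CommutativeSemigroup *-commutativeSemigroup using (x∙yz≈y∙xz)
open import Data.Nat.ListAction using (sum)
open import Data.List using (List; []; _∷_; map)
open import Data.List.Properties using (map-cong)
open import Data.List.Membership.Propositional using (_∈_)
open import Data.List.Relation.Unary.Any using (here; there)
open import Data.List.Relation.Unary.All using (All; []; _∷_)
import Data.List.Relation.Unary.All as All
open import Data.List.Relation.Unary.AllPairs using (_∷_)
open import Data.List.Relation.Unary.Unique.Propositional using (Unique)
open import Data.Product using (∃; ∃₂; _×_; _,_; proj₁; proj₂)
open import Data.Sum using (_⊎_; inj₁; inj₂; [_,_]′)
open import Function using (_∘_)
open import Relation.Nullary using (¬_; Dec; yes; no; contradiction)
open import Relation.Nullary.Decidable using (_×-dec_; decidable-stable)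
open import Relation.Binary.PropositionalEquality
open import Relation.Binary.Construct.Closure.ReflexiveTransitive using (Star; ε; _◅_)

module _ {X : Set} where

  sum-map-+ : ∀ (xs : List X) (f g : X → ℕ) →
    sum (map (λ x → f x + g x) xs) ≡ sum (map f xs) + sum (map g xs)
  sum-map-+ []       f g = refl
  sum-map-+ (x ∷ xs) f g rewrite sum-map-+ xs f g = interchange (f x) (g x) _ _

  sum-map-*ˡ : ∀ (xs : List X) k (f : X → ℕ) →
    sum (map (λ x → k * f x) xs) ≡ k * sum (map f xs)
  sum-map-*ˡ []       k f = sym (*-zeroʳ k)
  sum-map-*ˡ (x ∷ xs) k f rewrite sum-map-*ˡ xs k f = sym (*-distribˡ-+ k (f x) _)

  sum-map-0 : ∀ (xs : List X) → sum (map (λ _ → 0) xs) ≡ 0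
  sum-map-0 []       = refl
  sum-map-0 (x ∷ xs) = sum-map-0 xs

  ∈⇒≤sum-map : ∀ {xs x} (f : X → ℕ) → x ∈ xs → f x ≤ sum (map f xs)
  ∈⇒≤sum-map         f (here refl)  = m≤m+n _ _
  ∈⇒≤sum-map {y ∷ _} f (there x∈xs) = ≤-trans (∈⇒≤sum-map f x∈xs) (m≤n+m _ (f y))

  sum-map-pos : ∀ (xs : List X) (f : X → ℕ) → 0 < sum (map f xs) →
    ∃ λ x → x ∈ xs × 0 < f x
  sum-map-pos (x ∷ xs) f pos with f x in eq
  ... | zero  = let y , y∈xs , fy = sum-map-pos xs f pos in y , there y∈xs , fy
  ... | suc _ = x , here refl , ≤-trans (s≤s z≤n) (≤-reflexive (sym eq))

  sum-map-≥2 : ∀ {xs} (f : X → ℕ) → Unique xs → 2 ≤ sum (map f xs) →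
    (∃ λ x → 2 ≤ f x) ⊎ (∃₂ λ x y → x ≢ y × 0 < f x × 0 < f y)
  sum-map-≥2 {x ∷ xs} f (x∉xs ∷ distinct) h with f x in eq
  ... | zero        = sum-map-≥2 f distinct h
  ... | suc (suc _) = inj₁ (x , ≤-trans (s≤s (s≤s z≤n)) (≤-reflexive (sym eq)))
  ... | suc zero    =
        let y , y∈xs , fy = sum-map-pos xs f (s≤s⁻¹ h)
        in inj₂ (x , y , All.lookup x∉xs y∈xs , ≤-reflexive (sym eq) , fy)

sum-map-swap : ∀ {X Y : Set} (xs : List X) (ys : List Y) (f : X → Y → ℕ) →
  sum (map (λ x → sum (map (f x) ys)) xs) ≡ sum (map (λ y → sum (map (λ x → f x y) xs)) ys)
sum-map-swap []       ys f = sym (sum-map-0 ys)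
sum-map-swap (x ∷ xs) ys f rewrite sum-map-swap xs ys f = sym (sum-map-+ ys (f x) _)

module _ (A : FinSet) where

  δ-refl : ∀ a → δ A a a ≡ 1
  δ-refl a with _≟_ A a a
  ... | yes _   = refl
  ... | no a≢a = contradiction refl a≢a

  δ-≢ : ∀ {a b} → a ≢ b → δ A a b ≡ 0
  δ-≢ {a} {b} a≢b with _≟_ A a b
  ... | yes a≡b = contradiction a≡b a≢b
  ... | no _    = refl

  ≤δ*⇒≡×≤ : ∀ {a b k} n → 0 < k → k ≤ δ A a b * n → a ≡ b × k ≤ n
  ≤δ*⇒≡×≤ {a} {b} n pos le with _≟_ A a b
  ... | yes a≡b = a≡b , ≤-trans le (≤-reflexive (+-identityʳ n))
  ... | no _    = contradiction (≤-trans pos le) λ ()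

  ∑-δ : ∀ b (h : Carrier A → ℕ) → ∑ A (λ a → δ A b a * h a) ≡ h b
  ∑-δ b h = go (unique A) (complete A b)
    where
    absent : ∀ {xs} → All (b ≢_) xs → sum (map (λ a → δ A b a * h a) xs) ≡ 0
    absent []            = refl
    absent (b≢x ∷ b∉xs) rewrite δ-≢ b≢x = absent b∉xs

    go : ∀ {xs} → Unique xs → b ∈ xs → sum (map (λ a → δ A b a * h a) xs) ≡ h b
    go (b∉xs ∷ _) (here refl) rewrite δ-refl b | absent b∉xs =
      trans (+-identityʳ _) (+-identityʳ _)
    go (x∉xs ∷ distinct) (there b∈xs)
      rewrite δ-≢ (≢-sym (All.lookup x∉xs b∈xs)) = go distinct b∈xs

  pair : Carrier A → Carrier A → Carrier A → ℕ
  pair c d r = δ A c r + δ A d r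

  pair≤ : ∀ {c d} (D : Carrier A → ℕ) → 0 < D c → 0 < D d → (c ≡ d → 2 ≤ D c) →
    ∀ r → pair c d r ≤ D r
  pair≤ {c} {d} D c∈D d∈D cc∈D r with _≟_ A c r | _≟_ A d r
  ... | yes refl | yes refl = cc∈D refl
  ... | yes refl | no _     = c∈D
  ... | no _     | yes refl = d∈D
  ... | no _     | no _     = z≤n

  pair≤⁻ : ∀ {c d} (D : Carrier A → ℕ) → (∀ r → pair c d r ≤ D r) →
    0 < D c × 0 < D d × (c ≡ d → 2 ≤ D c)
  pair≤⁻ {c} {d} D le =
    ≤-trans (≤-trans (≤-reflexive (sym (δ-refl c))) (m≤m+n _ _)) (le c) ,
    ≤-trans (≤-trans (≤-reflexive (sym (δ-refl d))) (m≤n+m _ _)) (le d) ,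
    λ { refl → ≤-trans (≤-reflexive (sym (cong₂ _+_ (δ-refl c) (δ-refl c)))) (le c) }

module Pushforward {A B : FinSet} (g : Carrier A → Carrier B) where

  push : (Carrier A → ℕ) → Carrier B → ℕ
  push D b = ∑ A (λ a → δ B (g a) b * D a)

  push-cong : ∀ {D E} → (∀ a → D a ≡ E a) → ∀ b → push D b ≡ push E b
  push-cong D≗E b = cong sum (map-cong (λ a → cong (δ B (g a) b *_) (D≗E a)) (enum A))

  ∑-push : ∀ (h : Carrier B → ℕ) D → ∑ B (λ b → h b * push D b) ≡ ∑ A (λ a → h (g a) * D a)
  ∑-push h D = begin
    ∑ B (λ b → h b * push D b)
      ≡⟨ cong sum (map-cong (λ b → sym (sum-map-*ˡ (enum A) (h b) _)) (enum B)) ⟩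
    ∑ B (λ b → ∑ A (λ a → h b * (δ B (g a) b * D a)))
      ≡⟨ sum-map-swap (enum B) (enum A) _ ⟩
    ∑ A (λ a → ∑ B (λ b → h b * (δ B (g a) b * D a)))
      ≡⟨ cong sum (map-cong (λ a →
           cong sum (map-cong (λ b → x∙yz≈y∙xz (h b) (δ B (g a) b) (D a)) (enum B))) (enum A)) ⟩
    ∑ A (λ a → ∑ B (λ b → δ B (g a) b * (h b * D a)))
      ≡⟨ cong sum (map-cong (λ a → ∑-δ B (g a) (λ b → h b * D a)) (enum A)) ⟩
    ∑ A (λ a → h (g a) * D a) ∎
    where open ≡-Reasoning

  push-+ : ∀ D E b → push (λ a → D a + E a) b ≡ push D b + push E b
  push-+ D E b = trans
    (cong sum (map-cong (λ a → *-distribˡ-+ (δ B (g a) b) (D a) (E a)) (enum A)))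
    (sum-map-+ (enum A) _ _)

  push-∑ : ∀ (T : FinSet) (y : Carrier T → ℕ) (F : Carrier T → Carrier A → ℕ) b →
    push (λ a → ∑ T (λ t → y t * F t a)) b ≡ ∑ T (λ t → y t * push (F t) b)
  push-∑ T y F b = begin
    ∑ A (λ a → δ B (g a) b * ∑ T (λ t → y t * F t a))
      ≡⟨ cong sum (map-cong (λ a → sym (sum-map-*ˡ (enum T) (δ B (g a) b) _)) (enum A)) ⟩
    ∑ A (λ a → ∑ T (λ t → δ B (g a) b * (y t * F t a)))
      ≡⟨ sum-map-swap (enum A) (enum T) _ ⟩
    ∑ T (λ t → ∑ A (λ a → δ B (g a) b * (y t * F t a)))
      ≡⟨ cong sum (map-cong (λ t → trans
           (cong sum (map-cong (λ a → x∙yz≈y∙xz (δ B (g a) b) (y t) (F t a)) (enum A)))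
           (sum-map-*ˡ (enum A) (y t) _)) (enum T)) ⟩
    ∑ T (λ t → y t * push (F t) b) ∎
    where open ≡-Reasoning

  push-pair : ∀ c d b → push (pair A c d) b ≡ pair B (g c) (g d) b
  push-pair c d b = trans (push-+ (δ A c) (δ A d) b) (cong₂ _+_ (push-δ c) (push-δ d))
    where
    push-δ : ∀ c → push (δ A c) b ≡ δ B (g c) b
    push-δ c = trans (cong sum (map-cong (λ a → *-comm (δ B (g a) b) (δ A c a)) (enum A)))
                     (∑-δ A c (λ a → δ B (g a) b))

  push-pos : ∀ {D a} → 0 < D a → 0 < push D (g a)
  push-pos {D} {a} pos = ≤-trans pos (≤-trans
    (≤-reflexive (sym (trans (cong (_* D a) (δ-refl B (g a))) (+-identityʳ (D a)))))
    (∈⇒≤sum-map (λ a′ → δ B (g a′) (g a) * D a′) (complete A a)))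

  push-pos⁻ : ∀ {D b} → 0 < push D b → ∃ λ a → g a ≡ b × 0 < D a
  push-pos⁻ {D} {b} pos =
    let a , _ , pos′ = sum-map-pos (enum A) (λ a → δ B (g a) b * D a) pos
    in a , ≤δ*⇒≡×≤ B (D a) (s≤s z≤n) pos′

  push-≥2⁻ : ∀ {D b} → 2 ≤ push D b →
    ∃₂ λ c d → g c ≡ b × g d ≡ b × (∀ r → pair A c d r ≤ D r)
  push-≥2⁻ {D} {b} h with sum-map-≥2 (λ a → δ B (g a) b * D a) (unique A) h
  ... | inj₁ (c , 2≤δD) =
        let gc≡b , 2≤D = ≤δ*⇒≡×≤ B (D c) (s≤s z≤n) 2≤δD
            0<D = ≤-trans (s≤s z≤n) 2≤D
        in c , c , gc≡b , gc≡b , pair≤ A D 0<D 0<D (λ _ → 2≤D)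
  ... | inj₂ (c , d , c≢d , 0<δDc , 0<δDd) =
        let gc≡b , 0<Dc = ≤δ*⇒≡×≤ B (D c) (s≤s z≤n) 0<δDc
            gd≡b , 0<Dd = ≤δ*⇒≡×≤ B (D d) (s≤s z≤n) 0<δDd
        in c , d , gc≡b , gd≡b , pair≤ A D 0<Dc 0<Dd (λ c≡d → contradiction c≡d c≢d)

  pair≤push⁻ : ∀ {D a b} → (∀ r → pair B a b r ≤ push D r) →
    ∃₂ λ c d → g c ≡ a × g d ≡ b × (∀ r → pair A c d r ≤ D r)
  pair≤push⁻ {D} {a} {b} le with pair≤⁻ B (push D) le | _≟_ B a b
  ... | _ , _ , 2≤Da | yes refl = push-≥2⁻ (2≤Da refl)
  ... | 0<Da , 0<Db , _ | no a≢b with push-pos⁻ 0<Da | push-pos⁻ 0<Db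
  ... | c , refl , 0<Dc | d , refl , 0<Dd =
        c , d , refl , refl , pair≤ A D 0<Dc 0<Dd (λ c≡d → contradiction (cong g c≡d) a≢b)

module _ {Alph : FinSet} (𝒫 : Protocol Alph) where
  open Protocol 𝒫

  Silent : Tr 𝒫 → Set
  Silent (p , q , p′ , q′) = p ≡ p′ × q ≡ q′

  silent? : ∀ t → Dec (Silent t)
  silent? (p , q , p′ , q′) = _≟_ Q p p′ ×-dec _≟_ Q q q′

  silent-balanced : ∀ t → Silent t → ∀ r → pre 𝒫 t r ≡ post 𝒫 t r
  silent-balanced _ (refl , refl) r = refl

  silent-out⇒in : ∀ {P} t → Silent t → _∈Out_ 𝒫 t P → _∈In_ 𝒫 t P
  silent-out⇒in _ (refl , refl) out = out

  silent-in⇒out : ∀ {P} t → Silent t → _∈In_ 𝒫 t P → _∈Out_ 𝒫 t P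
  silent-in⇒out _ (refl , refl) in′ = in′

  weighted : (Tr 𝒫 → ℕ) → (Tr 𝒫 → Config 𝒫) → Config 𝒫
  weighted x F q = ∑ (Trans Q) (λ t → x t * F t q)

  FlowEquations : Config 𝒫 → Config 𝒫 → (Tr 𝒫 → ℕ) → Set
  FlowEquations C C′ x = ∀ q → C′ q + weighted x (pre 𝒫) q ≡ C q + weighted x (post 𝒫) q

  dropSilent : (Tr 𝒫 → ℕ) → Tr 𝒫 → ℕ
  dropSilent x t with silent? t
  ... | yes _ = 0
  ... | no _  = x t

  dropSilent-supp : ∀ x t → dropSilent x t ≢ 0 → ¬ Silent t × x t ≢ 0
  dropSilent-supp x t nz with silent? t
  ... | yes _      = contradiction refl nz
  ... | no ¬silent = ¬silent , nz

  dropSilent-keeps : ∀ x t → ¬ Silent t → dropSilent x t ≡ x t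
  dropSilent-keeps x t ¬silent with silent? t
  ... | yes silent = contradiction silent ¬silent
  ... | no _       = refl

  -- Silent transitions contribute equally to both sides of the flow equations.
  flow-dropSilent : ∀ {C C′ x} → FlowEquations C C′ x → FlowEquations C C′ (dropSilent x)
  flow-dropSilent {C} {C′} {x} flow q = +-cancelʳ-≡ (Σs (pre 𝒫)) _ _ (begin
    C′ q + Σd (pre 𝒫) + Σs (pre 𝒫)     ≡⟨ +-assoc (C′ q) _ _ ⟩
    C′ q + (Σd (pre 𝒫) + Σs (pre 𝒫))   ≡⟨ cong (C′ q +_) (split (pre 𝒫)) ⟨
    C′ q + weighted x (pre 𝒫) q        ≡⟨ flow q ⟩
    C q + weighted x (post 𝒫) q        ≡⟨ cong (C q +_) (split (post 𝒫)) ⟩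
    C q + (Σd (post 𝒫) + Σs (post 𝒫))  ≡⟨ cong (λ s → C q + (Σd (post 𝒫) + s)) balanced ⟨
    C q + (Σd (post 𝒫) + Σs (pre 𝒫))   ≡⟨ +-assoc (C q) _ _ ⟨
    C q + Σd (post 𝒫) + Σs (pre 𝒫)     ∎)
    where
    open ≡-Reasoning

    silentPart : Tr 𝒫 → ℕ
    silentPart t with silent? t
    ... | yes _ = x t
    ... | no _  = 0

    Σd Σs : (Tr 𝒫 → Config 𝒫) → ℕ
    Σd F = weighted (dropSilent x) F q
    Σs F = weighted silentPart F q

    split : ∀ F → weighted x F q ≡ Σd F + Σs F
    split F = trans (cong sum (map-cong split₁ (enum (Trans Q)))) (sum-map-+ (enum (Trans Q)) _ _)
      where
      split₁ : ∀ t → x t * F t q ≡ dropSilent x t * F t q + silentPart t * F t q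
      split₁ t with silent? t
      ... | yes _ = refl
      ... | no _  = sym (+-identityʳ _)

    balanced : Σs (pre 𝒫) ≡ Σs (post 𝒫)
    balanced = cong sum (map-cong balanced₁ (enum (Trans Q)))
      where
      balanced₁ : ∀ t → silentPart t * pre 𝒫 t q ≡ silentPart t * post 𝒫 t q
      balanced₁ t with silent? t
      ... | yes silent = cong (x t *_) (silent-balanced t silent q)
      ... | no _       = refl

  terminal-balanced : ∀ {C t} → Terminal 𝒫 C → T t → (∀ r → pre 𝒫 t r ≤ C r) →
    ∀ r → post 𝒫 t r ≡ pre 𝒫 t r
  terminal-balanced {C} {t} terminal Tt enabled r =
    +-cancelˡ-≡ (C r ∸ pre 𝒫 t r) _ _
      (trans (terminal _ ((t , Tt , enabled , λ _ → refl) ◅ ε) r) (sym (m∸n+n≡m (enabled r))))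

  terminal-if-steps-return : ∀ {C} →
    (∀ {E E′} → (∀ q → E q ≡ C q) → Step 𝒫 E E′ → ∀ q → E′ q ≡ C q) → Terminal 𝒫 C
  terminal-if-steps-return {C} returns C′ path = go path (λ _ → refl)
    where
    go : ∀ {E D} → Star (Step 𝒫) E D → (∀ q → E q ≡ C q) → ∀ q → D q ≡ C q
    go ε            E≗C = E≗C
    go (step ◅ path) E≗C = go path (returns E≗C step)

record Projection {Alph : FinSet} (𝒫 𝒫′ : Protocol Alph) : Set where
  private
    module 𝒫  = Protocol 𝒫
    module 𝒫′ = Protocol 𝒫′
  field
    state      : Carrier 𝒫.Q → Carrier 𝒫′.Q
    state-init : ∀ σ → state (𝒫.I σ) ≡ 𝒫′.I σ
    transition : ∀ {p q p′ q′} → 𝒫.T (p , q , p′ , q′) →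
                 𝒫′.T (state p , state q , state p′ , state q′)
                 ⊎ Silent 𝒫′ (state p , state q , state p′ , state q′)
    lift       : ∀ {p q a′ b′} → 𝒫′.T (state p , state q , a′ , b′) →
                 ∃₂ λ p′ q′ → 𝒫.T (p , q , p′ , q′) × state p′ ≡ a′ × state q′ ≡ b′

module _ {Alph : FinSet} {𝒫 𝒫′ : Protocol Alph} (φ : Projection 𝒫 𝒫′) where
  open Projection φ
  private
    module 𝒫  = Protocol 𝒫
    module 𝒫′ = Protocol 𝒫′

  mapT : Tr 𝒫 → Tr 𝒫′
  mapT (p , q , p′ , q′) = state p , state q , state p′ , state q′

  open Pushforward {𝒫.Q} {𝒫′.Q} state renaming (push to project)
  private
    module PushT = Pushforward {Trans 𝒫.Q} {Trans 𝒫′.Q} mapT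

  project-pre : ∀ t q → project (pre 𝒫 t) q ≡ pre 𝒫′ (mapT t) q
  project-pre (p , q , _ , _) = push-pair p q

  project-post : ∀ t q → project (post 𝒫 t) q ≡ post 𝒫′ (mapT t) q
  project-post (_ , _ , p′ , q′) = push-pair p′ q′

  project-population : ∀ {C} → IsPopulation 𝒫.Q C → IsPopulation 𝒫′.Q (project C)
  project-population {C} pop = ≤-trans pop (≤-reflexive (sym (begin
    ∑ 𝒫′.Q (project C)                     ≡⟨ cong sum (map-cong (λ q → sym (*-identityˡ _)) (enum 𝒫′.Q)) ⟩
    ∑ 𝒫′.Q (λ q → 1 * project C q)        ≡⟨ ∑-push (λ _ → 1) C ⟩
    ∑ 𝒫.Q (λ c → 1 * C c)                 ≡⟨ cong sum (map-cong (λ c → *-identityˡ _) (enum 𝒫.Q)) ⟩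
    ∑ 𝒫.Q C                                ∎)))
    where open ≡-Reasoning

  count-project : ∀ C P → count 𝒫′ (project C) P ≡ count 𝒫 C (P ∘ state)
  count-project C P = begin
    ∑ 𝒫′.Q (λ q → if P q then project C q else 0)
      ≡⟨ cong sum (map-cong (λ q → if-as-* (P q) _) (enum 𝒫′.Q)) ⟩
    ∑ 𝒫′.Q (λ q → indicator (P q) * project C q)
      ≡⟨ ∑-push (indicator ∘ P) C ⟩
    ∑ 𝒫.Q (λ c → indicator (P (state c)) * C c)
      ≡⟨ cong sum (map-cong (λ c → if-as-* (P (state c)) _) (enum 𝒫.Q)) ⟨
    ∑ 𝒫.Q (λ c → if P (state c) then C c else 0) ∎
    where
    open ≡-Reasoning

    indicator : Bool → ℕ
    indicator b = if b then 1 else 0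

    if-as-* : ∀ b n → (if b then n else 0) ≡ indicator b * n
    if-as-* true  n = sym (*-identityˡ n)
    if-as-* false n = refl

  project-initial : ∀ X q → project (initial 𝒫 X) q ≡ initial 𝒫′ X q
  project-initial X q = trans (Pushforward.∑-push {Alph} {𝒫.Q} 𝒫.I (λ c → δ 𝒫′.Q (state c) q) X)
    (cong sum (map-cong (λ σ → cong (λ s → δ 𝒫′.Q s q * X σ) (state-init σ)) (enum Alph)))

  project-terminal : ∀ {C} → Terminal 𝒫 C → Terminal 𝒫′ (project C)
  project-terminal {C} terminal = terminal-if-steps-return 𝒫′ returns
    where
    returns : ∀ {E E′} → (∀ q → E q ≡ project C q) → Step 𝒫′ E E′ → ∀ q → E′ q ≡ project C q
    returns {E} {E′} E≗ ((a , b , a′ , b′) , T′w , enabled , fire) q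
      with pair≤push⁻ (λ r → subst (pre 𝒫′ (a , b , a′ , b′) r ≤_) (E≗ r) (enabled r))
    ... | c , d , refl , refl , enabledC with lift T′w
    ... | c′ , d′ , Tt , refl , refl = begin
      E′ q                                ≡⟨ fire q ⟩
      E q ∸ pre 𝒫′ w q + post 𝒫′ w q       ≡⟨ cong (E q ∸ pre 𝒫′ w q +_) balanced ⟩
      E q ∸ pre 𝒫′ w q + pre 𝒫′ w q        ≡⟨ m∸n+n≡m (enabled q) ⟩
      E q                                 ≡⟨ E≗ q ⟩
      project C q                         ∎
      where
      open ≡-Reasoning
      t = c , d , c′ , d′
      w = mapT t
      balanced : post 𝒫′ w q ≡ pre 𝒫′ w q
      balanced = trans (sym (project-post t q))
        (trans (push-cong (terminal-balanced 𝒫 terminal Tt enabledC) q) (project-pre t q))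

  project-weighted : ∀ (F : Tr 𝒫 → Config 𝒫) (F′ : Tr 𝒫′ → Config 𝒫′) →
    (∀ t q → project (F t) q ≡ F′ (mapT t) q) →
    ∀ x q → weighted 𝒫′ (PushT.push x) F′ q ≡ project (weighted 𝒫 x F) q
  project-weighted F F′ projectF x q = begin
    ∑ (Trans 𝒫′.Q) (λ w → PushT.push x w * F′ w q)
      ≡⟨ cong sum (map-cong (λ w → *-comm (PushT.push x w) _) (enum (Trans 𝒫′.Q))) ⟩
    ∑ (Trans 𝒫′.Q) (λ w → F′ w q * PushT.push x w)
      ≡⟨ PushT.∑-push (λ w → F′ w q) x ⟩
    ∑ (Trans 𝒫.Q) (λ t → F′ (mapT t) q * x t)
      ≡⟨ cong sum (map-cong (λ t → trans (*-comm _ (x t)) (cong (x t *_) (sym (projectF t q))))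
           (enum (Trans 𝒫.Q))) ⟩
    ∑ (Trans 𝒫.Q) (λ t → x t * project (F t) q)
      ≡⟨ push-∑ (Trans 𝒫.Q) x F q ⟨
    project (weighted 𝒫 x F) q ∎
    where open ≡-Reasoning

  project-flow : ∀ {C C′ x} → FlowEquations 𝒫 C C′ x →
    FlowEquations 𝒫′ (project C) (project C′) (PushT.push x)
  project-flow {C} {C′} {x} flow q = begin
    project C′ q + weighted 𝒫′ (PushT.push x) (pre 𝒫′) q
      ≡⟨ cong (project C′ q +_) (project-weighted (pre 𝒫) (pre 𝒫′) project-pre x q) ⟩
    project C′ q + project (weighted 𝒫 x (pre 𝒫)) q
      ≡⟨ push-+ C′ _ q ⟨
    project (λ c → C′ c + weighted 𝒫 x (pre 𝒫) c) q
      ≡⟨ push-cong flow q ⟩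
    project (λ c → C c + weighted 𝒫 x (post 𝒫) c) q
      ≡⟨ push-+ C _ q ⟩
    project C q + project (weighted 𝒫 x (post 𝒫)) q
      ≡⟨ cong (project C q +_) (project-weighted (post 𝒫) (post 𝒫′) project-post x q) ⟨
    project C q + weighted 𝒫′ (PushT.push x) (post 𝒫′) q ∎
    where open ≡-Reasoning

  -- The witness is the pushforward of x with the silent transitions removed:
  -- these need not belong to 𝒫′, but carry no flow.
  project-potReach : ∀ {C₀ C₀′ C} → (∀ q → project C₀ q ≡ C₀′ q) →
    PotReach 𝒫 C₀ C → PotReach 𝒫′ C₀′ (project C)
  project-potReach {C₀} {C₀′} {C} C₀≗ (x , x-on-T , flow , traps , siphons) =
    x′ , x′-on-T , flow′ , traps′ , siphons′
    where
    x′ : Tr 𝒫′ → ℕ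
    x′ = dropSilent 𝒫′ (PushT.push x)

    support : ∀ {w} → x′ w ≢ 0 → ∃ λ t → mapT t ≡ w × ¬ Silent 𝒫′ w × x t ≢ 0
    support {w} nz =
      let ¬silent , push≢0 = dropSilent-supp 𝒫′ (PushT.push x) w nz
          t , t↦w , 0<x = PushT.push-pos⁻ (n≢0⇒n>0 push≢0)
      in t , t↦w , ¬silent , n>0⇒n≢0 0<x

    covers : ∀ t → ¬ Silent 𝒫′ (mapT t) → x t ≢ 0 → x′ (mapT t) ≢ 0
    covers t ¬silent nz = subst (_≢ 0) (sym (dropSilent-keeps 𝒫′ _ (mapT t) ¬silent))
      (n>0⇒n≢0 (PushT.push-pos (n≢0⇒n>0 nz)))

    x′-on-T : ∀ w → ¬ 𝒫′.T w → x′ w ≡ 0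
    x′-on-T w ¬T′w = decidable-stable (x′ w ≟ℕ 0) (impossible ∘ support)
      where
      impossible : ¬ (∃ λ t → mapT t ≡ w × ¬ Silent 𝒫′ w × x t ≢ 0)
      impossible ((_ , _ , _ , _) , refl , ¬silent , nz) =
        nz (x-on-T _ λ Tt → [ ¬T′w , ¬silent ]′ (transition Tt))

    flow′ : FlowEquations 𝒫′ C₀′ (project C) x′
    flow′ = flow-dropSilent 𝒫′ λ q →
      subst (λ n → project C q + _ ≡ n + _) (C₀≗ q) (project-flow flow q)

    pullback-trap : ∀ {P} → IsTrap 𝒫′ (λ w → x′ w ≢ 0) P →
      IsTrap 𝒫 (λ t → x t ≢ 0) (P ∘ state)
    pullback-trap {P} trap t@(_ , _ , _ , _) out nz with silent? 𝒫′ (mapT t)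
    ... | yes silent  = silent-out⇒in 𝒫′ {P} (mapT t) silent out
    ... | no ¬silent = trap (mapT t) out (covers t ¬silent nz)

    pullback-siphon : ∀ {P} → IsSiphon 𝒫′ (λ w → x′ w ≢ 0) P →
      IsSiphon 𝒫 (λ t → x t ≢ 0) (P ∘ state)
    pullback-siphon {P} siphon t@(_ , _ , _ , _) in′ nz with silent? 𝒫′ (mapT t)
    ... | yes silent  = silent-in⇒out 𝒫′ {P} (mapT t) silent in′
    ... | no ¬silent = siphon (mapT t) in′ (covers t ¬silent nz)

    traps′ : ∀ P → IsTrap 𝒫′ (λ w → x′ w ≢ 0) P → count 𝒫′ (project C) P ≡ 0 →
      ∀ w → _∈In_ 𝒫′ w P → ¬ x′ w ≢ 0
    traps′ P trap empty w in′ nz with support nz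
    ... | (_ , _ , _ , _) , refl , _ , x≢0 =
          traps (P ∘ state) (pullback-trap trap) (trans (sym (count-project C P)) empty) _ in′ x≢0

    siphons′ : ∀ P → IsSiphon 𝒫′ (λ w → x′ w ≢ 0) P → count 𝒫′ C₀′ P ≡ 0 →
      ∀ w → _∈Out_ 𝒫′ w P → ¬ x′ w ≢ 0
    siphons′ P siphon empty w out nz with support nz
    ... | (_ , _ , _ , _) , refl , _ , x≢0 =
          siphons (P ∘ state) (pullback-siphon siphon) empty₀ _ out x≢0
      where
      empty₀ : count 𝒫 C₀ (P ∘ state) ≡ 0
      empty₀ = trans (sym (count-project C₀ P)) (trans
        (cong sum (map-cong (λ q → cong (if P q then_else 0) (C₀≗ q)) (enum 𝒫′.Q))) empty)

  project-consensus : ∀ {X b} →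
    (∀ C′ → IsPopulation 𝒫′.Q C′ → Terminal 𝒫′ C′ → PotReach 𝒫′ (initial 𝒫′ X) C′ →
      ConsensusWith 𝒫′ C′ b) →
    ∀ C → IsPopulation 𝒫.Q C → Terminal 𝒫 C → PotReach 𝒫 (initial 𝒫 X) C →
    ∀ c → 0 < C c → 𝒫′.O (state c) ≡ b
  project-consensus consensus C pop terminal reach c pos =
    consensus (project C) (project-population pop) (project-terminal terminal)
      (project-potReach (project-initial _) reach) (state c) (push-pos pos)

module _ {Alph : FinSet} (𝒫₁ 𝒫₂ : Protocol Alph) where

  conjunction-proj₁ : Projection (conjunction 𝒫₁ 𝒫₂) 𝒫₁
  conjunction-proj₁ = record
    { state      = proj₁
    ; state-init = λ _ → refl
    ; transition = λ { (inj₁ (_ , T₁t , _ , _ , refl)) → inj₁ T₁t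
                     ; (inj₂ (_ , _ , _ , _ , refl))   → inj₂ (refl , refl) }
    ; lift       = λ { {_ , r} {_ , r′} {a′} {b′} T₁t →
                       (a′ , r) , (b′ , r′) , inj₁ (_ , T₁t , r , r′ , refl) , refl , refl }
    }

  conjunction-proj₂ : Projection (conjunction 𝒫₁ 𝒫₂) 𝒫₂
  conjunction-proj₂ = record
    { state      = proj₂
    ; state-init = λ _ → refl
    ; transition = λ { (inj₁ (_ , _ , _ , _ , refl))   → inj₂ (refl , refl)
                     ; (inj₂ (_ , T₂t , _ , _ , refl)) → inj₁ T₂t }
    ; lift       = λ { {r , _} {r′ , _} {a′} {b′} T₂t →
                       (r , a′) , (r′ , b′) , inj₂ (_ , T₂t , r , r′ , refl) , refl , refl }
    }

lemma3 : {Alph : FinSet} (𝒫₁ 𝒫₂ : Protocol Alph) →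
    StrongConsensus 𝒫₁ → StrongConsensus 𝒫₂ →
    StrongConsensus (conjunction 𝒫₁ 𝒫₂)
lemma3 𝒫₁ 𝒫₂ consensus₁ consensus₂ X pop =
  let b₁ , agree₁ = consensus₁ X pop
      b₂ , agree₂ = consensus₂ X pop
  in b₁ ∧ b₂ , λ C pop′ terminal reach → λ { (p , r) pos → cong₂ _∧_
       (project-consensus (conjunction-proj₁ 𝒫₁ 𝒫₂) agree₁ C pop′ terminal reach (p , r) pos)
       (project-consensus (conjunction-proj₂ 𝒫₁ 𝒫₂) agree₂ C pop′ terminal reach (p , r) pos) }
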